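{- For any set $\Gamma\cup\{\varphi,\psi\}$ of $\mathcal{PCO}_\sigma$ formulas, if $\Gamma\cup\{\varphi\}\vdash\psi$, then $\Gamma\vdash\varphi\to\psi$.
   Context: Signature $\sigma=(\mathrm{Dom},\mathrm{Ran})$: a finite nonempty set $\mathrm{Dom}$ of variables with a fixed ordering, and finite nonempty value sets $\mathrm{Ran}(X)$; $\mathbf W_V$ lists $\mathrm{Dom}\setminus\{V\}$ in order, $\mathbf W_{XY}$ lists $\mathrm{Dom}\setminus\{X,Y\}$. $\mathbf X=\mathbf x$ abbreviates $X_1=x_1\wedge\dots\wedge X_n=x_n$; it is consistent unless some variable is assigned two distinct values. Language $\mathcal{CO}_\sigma$: $\alpha::= Y=y\mid Y\neq y\mid\alpha\wedge\alpha\mid\alpha\supset\alpha\mid \mathbf X=\mathbf x\,\Box\!\!\to\alpha$ ($y\in\mathrm{Ran}(Y)$, $\mathbf x\in\mathrm{Ran}(\mathbf X)$). Abbreviations: $\top:=X=x\,\Box\!\!\to X=x$, $\bot:=X=x\,\Box\!\!\to X\neq x$ (fixed $X,x$), $\neg\alpha:=\alpha\supset\bot$, $\alpha\vee\beta:=\neg(\neg\alpha\wedge\neg\beta)$, $\alpha\equiv\beta:=(\alpha\supset\beta)\wedge(\beta\supset\alpha)$. Language $\mathcal{PCO}_\sigma$: $\varphi::=\eta\mid\varphi\wedge\varphi\mid\varphi\sqcup\varphi\mid\alpha\supset\varphi\mid\mathbf X=\mathbf x\,\Box\!\!\to\varphi$, $\alpha\in\mathcal{CO}$, $\eta$ a literal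 $Y=y$, $Y\neq y$ or a probabilistic atom $\Pr(\alpha)\geq\epsilon$, $\Pr(\alpha)>\epsilon$, $\Pr(\alpha)\geq\Pr(\beta)$, $\Pr(\alpha)>\Pr(\beta)$ ($\alpha,\beta\in\mathcal{CO}$, $\epsilon\in[0,1]\cap\mathbb Q$). Abbreviations: $\Pr(\alpha)\leq\epsilon:=\Pr(\neg\alpha)\geq1-\epsilon$; $\Pr(\alpha)<\epsilon:=\Pr(\neg\alpha)>1-\epsilon$; $\Pr(\alpha)=\epsilon:=\Pr(\alpha)\geq\epsilon\wedge\Pr(\alpha)\leq\epsilon$; $\Pr(\alpha)\neq\epsilon:=\Pr(\alpha)>\epsilon\sqcup\Pr(\alpha)<\epsilon$. The operation $\varphi\mapsto\varphi^C$: $(\Pr(\alpha)\geq\epsilon)^C=\Pr(\alpha)<\epsilon$ and vice versa; $(\Pr(\alpha)>\epsilon)^C=\Pr(\alpha)\leq\epsilon$ and vice versa; $(\Pr(\alpha)=\epsilon)^C=\Pr(\alpha)\neq\epsilon$ and vice versa; $(\Pr(\alpha)\geq\Pr(\beta))^C=\Pr(\beta)>\Pr(\alpha)$ and vice versa; $\bot^C=\top$ and vice versa; $(X=x)^C=\Pr(X=x)<1$; $(X\neq x)^C=\Pr(X\neq x)<1$; $(\psi\wedge\chi)^C=\psi^C\sqcup\chi^C$; $(\psi\sqcup\chi)^C=\psi^C\wedge\chi^C$; $(\alpha\supset\chi)^C=\Pr(\alpha)>0\wedge\alpha\supset\chi^C$; $(\mathbf X=\mathbf x\,\Box\!\!\to\chi)^C=\mathbf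 X=\mathbf x\,\Box\!\!\to\chi^C$. $\psi\to\chi:=\psi^C\sqcup\chi$, $\psi\leftrightarrow\chi:=(\psi\to\chi)\wedge(\chi\to\psi)$; $\mathbf Y\neq\mathbf y:=Y_1\neq y_1\sqcup\dots\sqcup Y_n\neq y_n$; $\bigvee,\bigsqcup,\bigwedge$ iterate $\vee,\sqcup,\wedge$. Auxiliary formulas: $\varphi_{DC(X,Y)}:=\bigvee_{x\neq x',\,y\neq y',\,\mathbf w\in\mathrm{Ran}(\mathbf W_{XY})}[((\mathbf W_{XY}=\mathbf w\wedge X=x)\Box\!\!\to Y=y)\wedge((\mathbf W_{XY}=\mathbf w\wedge X=x')\Box\!\!\to Y=y')]$; $\varphi_{End(Y)}:=\bigsqcup_{X\in\mathbf W_Y}\varphi_{DC(X,Y)}$; $X\leadsto Y:=\bigvee_{\mathbf Z\subseteq\mathrm{Dom}\setminus\{X\},\,\mathbf z,\,x\neq x',\,y\neq y'}[((\mathbf Z=\mathbf z\wedge X=x)\Box\!\!\to Y=y)\wedge((\mathbf Z=\mathbf z\wedge X=x')\Box\!\!\to Y=y')]$. Deduction system ($\alpha,\beta$ in $\mathcal{CO}$; $\psi,\chi,\varphi,\theta$ in $\mathcal{PCO}$; $\delta,\epsilon\in[0,1]\cap\mathbb Q$). Axioms: T1: substitution instances of classical tautologies in $\wedge,\sqcup,\to,{}^C,\top,\bot$. T2: $\mathcal{CO}$ instances of classical tautologies in $\wedge,\vee,\supset,\neg,\top,\bot$. P1: $\alpha\leftrightarrow\Pr(\alpha)=1$. P2: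 $\Pr(\alpha)\geq0$. P3: $(\Pr(\alpha)=\delta\wedge\Pr(\beta)=\epsilon\wedge\Pr(\alpha\wedge\beta)=0)\to\Pr(\alpha\vee\beta)=\delta+\epsilon$ ($\delta+\epsilon\leq1$). P3b: $\Pr(\alpha)\geq\epsilon\wedge\Pr(\alpha\wedge\beta)=0\to\Pr(\beta)\leq1-\epsilon$. P4: $\Pr(\alpha)\leq\epsilon\to\Pr(\alpha)<\delta$ ($\delta>\epsilon$). P5: $\Pr(\alpha)<\epsilon\to\Pr(\alpha)\leq\epsilon$. P6: $\Pr(\alpha\equiv\beta)=1\to(\Pr(\alpha)=\epsilon\to\Pr(\beta)=\epsilon)$. P6b: $\Pr(\alpha\supset\beta)=1\to(\Pr(\alpha)=\epsilon\to\Pr(\beta)\geq\epsilon)$. CP1: $(\Pr(\alpha)=\delta\wedge\Pr(\beta)=\epsilon)\to\Pr(\alpha)\geq\Pr(\beta)$ ($\delta\geq\epsilon$). CP2: same with $>$ ($\delta>\epsilon$). O1: $\Pr(\alpha)=0\to(\alpha\supset\psi)$. O1b: $(\alpha\supset\bot)\to\Pr(\alpha)=0$. O2: $(\Pr(\alpha)=\delta\wedge\Pr(\alpha\wedge\beta)=\epsilon)\to(\alpha\supset\Pr(\beta)=\frac{\epsilon}{\delta})$ ($\delta\neq0$). O3: $(\alpha\supset\Pr(\beta)=\epsilon)\to(\Pr(\alpha)=\delta\leftrightarrow\Pr(\alpha\wedge\beta)=\epsilon\cdot\delta)$ ($\epsilon\neq0$). O4: $(\alpha\supset\psi)\to(\alpha\to\psi)$.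 O5$_\wedge$: $\alpha\supset(\psi\wedge\chi)\leftrightarrow(\alpha\supset\psi)\wedge(\alpha\supset\chi)$. O5$_\sqcup$: same with $\sqcup$. O5$_\supset$: $\alpha\supset(\beta\supset\chi)\leftrightarrow(\alpha\wedge\beta)\supset\chi$. A1: $\mathbf Y=\mathbf y\to\mathbf Y\neq\mathbf y'$ ($\mathbf y\neq\mathbf y'$). A2: $X\neq x\leftrightarrow(X=x\supset\bot)$. A3: $\bigvee_{\mathbf y\in\mathrm{Ran}(\mathbf Y)}\mathbf Y=\mathbf y$. C1: $(\mathbf X=\mathbf x\Box\!\!\to(\psi\wedge\chi))\leftrightarrow((\mathbf X=\mathbf x\Box\!\!\to\psi)\wedge(\mathbf X=\mathbf x\Box\!\!\to\chi))$. C2: same with $\sqcup$. C3: $(\mathbf X=\mathbf x\Box\!\!\to(\alpha\supset\chi))\leftrightarrow((\mathbf X=\mathbf x\Box\!\!\to\alpha)\supset(\mathbf X=\mathbf x\Box\!\!\to\chi))$. C4: $(\mathbf X=\mathbf x\Box\!\!\to(\mathbf Y=\mathbf y\Box\!\!\to\chi))\to((\mathbf X'=\mathbf x'\wedge\mathbf Y=\mathbf y)\Box\!\!\to\chi)$, $\mathbf X'=\mathbf X\setminus\mathbf Y$, $\mathbf x'$ corresponding values, $\mathbf X=\mathbf x$ consistent. C4b: $((\mathbf X=\mathbf x\wedge\mathbf Y=\mathbf y)\Box\!\!\to\chi)\to(\mathbf X=\mathbf x\Box\!\!\to(\mathbf Y=\mathbf y\Box\!\!\to\chi))$. C5: $(\mathbf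 X=\mathbf x\Box\!\!\to\bot)\to\psi$ ($\mathbf X=\mathbf x$ consistent). C6: $(\mathbf X=\mathbf x\wedge Y=y)\Box\!\!\to Y=y$. C7: $(\mathbf X=\mathbf x\wedge\gamma)\to(\mathbf X=\mathbf x\Box\!\!\to\gamma)$, $\gamma\in\mathcal{PCO}$ without $\Box\!\!\to$. C8: $(\mathbf X=\mathbf x\Box\!\!\to\Pr(\alpha)\rhd\epsilon)\leftrightarrow\Pr(\mathbf X=\mathbf x\Box\!\!\to\alpha)\rhd\epsilon$ ($\rhd\in\{\geq,>\}$). C8b: $(\mathbf X=\mathbf x\Box\!\!\to\Pr(\alpha)\rhd\Pr(\beta))\leftrightarrow\Pr(\mathbf X=\mathbf x\Box\!\!\to\alpha)\rhd\Pr(\mathbf X=\mathbf x\Box\!\!\to\beta)$. C9: $\varphi_{End(Y)}\to(\mathbf W_Y=\mathbf w\Box\!\!\to\bigsqcup_{y}Y=y)$. C10: $(\varphi_{End(Y)})^C\to(Y=y\supset(\mathbf W_Y=\mathbf w\Box\!\!\to Y=y))$. C11: $(X_1\leadsto X_2\wedge\dots\wedge X_{n-1}\leadsto X_n)\to(X_n\leadsto X_1)^C$ ($n>1$). Rules: MP (from $\psi$, $\psi\to\chi$ infer $\chi$); Rep (from $\vdash\varphi$, $\vdash\theta\leftrightarrow\theta'$ infer $\vdash\varphi[\theta'/\theta]$ if well-formed); $\bot^\omega$ (from $\psi\to\Pr(\alpha)\neq\epsilon$ for all $\epsilon\in[0,1]\cap\mathbb Q$ infer $\psi\to\bot$); Mon$_\supset$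 (from $\vdash\psi\to\chi$ infer $\vdash(\alpha\supset\psi)\to(\alpha\supset\chi)$); $\to$to$\supset$ (from $\vdash\alpha\to\psi$ infer $\vdash\alpha\supset\psi$); $\supset^\omega$ (from $\psi\to(\Pr(\alpha\wedge\beta)=\delta\epsilon\leftrightarrow\Pr(\alpha)=\epsilon)$ for all $\epsilon\in(0,1]\cap\mathbb Q$ infer $\psi\to(\alpha\supset\Pr(\beta)=\delta)$); Mon$_{\Box\!\to}$ (from $\vdash\psi\to\chi$ infer $\vdash(\mathbf X=\mathbf x\Box\!\!\to\psi)\to(\mathbf X=\mathbf x\Box\!\!\to\chi)$). $\Gamma\vdash\varphi$ iff there is a sequence indexed by ordinals $\leq\kappa$ (countable) ending in $\varphi$, each term an axiom, in $\Gamma$, or obtained from earlier terms by a rule, where Rep, Mon$_\supset$, Mon$_{\Box\!\to}$, $\to$to$\supset$ apply only to theorems (formulas derivable from $\emptyset$). -}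

module Defs where

open import Level using (0ℓ)
open import Data.Nat using (ℕ; zero; suc)
open import Data.Fin using (Fin; zero; suc) renaming (_≟_ to _≟F_)
open import Data.Bool as B using (Bool; true; false; not)
open import Data.Product using (Σ; _×_; _,_; proj₁; proj₂)
open import Data.List using (List; []; _∷_; map; filter; concatMap; _++_; allFin)
open import Data.List.NonEmpty as L⁺ using (List⁺; _∷_; _++⁺_; _⁺++⁺_; toList)
open import Data.List.Membership.Propositional using (_∈_)
open import Data.Rational as Q using (ℚ; 0ℚ; 1ℚ; _≤_; _<_; NonZero)
open import Data.Rational.Properties
open import Relation.Binary.PropositionalEquality using (_≡_; _≢_; subst)
open import Relation.Nullary using (¬_; ¬?)
open import Relation.Unary using (Pred; ∅)

record I01 : Set where
  constructor ⟨_,_,_⟩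
  field
    val : ℚ
    lo  : 0ℚ ≤ val
    hi  : val ≤ 1ℚ
open I01 public

InUnit : ℚ → Set
InUnit q = (0ℚ ≤ q) × (q ≤ 1ℚ)

mkI : (q : ℚ) → InUnit q → I01
mkI q (l , h) = ⟨ q , l , h ⟩

zeroI : I01
zeroI = ⟨ 0ℚ , ≤-refl , *≤* (Data.Integer.+≤+ Data.Nat.z≤n) ⟩
  where import Data.Integer ; open Q using (*≤*)

oneI : I01
oneI = ⟨ 1ℚ , *≤* (Data.Integer.+≤+ Data.Nat.z≤n) , ≤-refl ⟩
  where import Data.Integer ; open Q using (*≤*)

oneMinus : I01 → I01
oneMinus ⟨ q , l , h ⟩ = ⟨ 1ℚ Q.- q , a , b ⟩
  where
  a : 0ℚ ≤ 1ℚ Q.- q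
  a = subst (_≤ 1ℚ Q.- q) (+-inverseʳ 1ℚ) (+-monoʳ-≤ 1ℚ (neg-antimono-≤ h))
  b : 1ℚ Q.- q ≤ 1ℚ
  b = subst (1ℚ Q.- q ≤_) (+-identityʳ 1ℚ) (+-monoʳ-≤ 1ℚ (neg-antimono-≤ l))

timesI : I01 → I01 → I01
timesI ⟨ p , lp , hp ⟩ ⟨ q , lq , hq ⟩ = ⟨ p Q.* q , a , b ⟩
  where
  instance _ = Q.nonNegative lp
  a : 0ℚ ≤ p Q.* q
  a = subst (_≤ p Q.* q) (*-zeroʳ p) (*-monoˡ-≤-nonNeg p lq)
  b : p Q.* q ≤ 1ℚ
  b = ≤-trans (subst (p Q.* q ≤_) (*-identityʳ p) (*-monoˡ-≤-nonNeg p hq)) hp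

-- Signatures: Dom = Fin (suc n) (nonempty, ordered as Fin),
-- Ran(X) = Fin (suc (ran X)) (nonempty)

record Signature : Set where
  field
    n   : ℕ
    ran : Fin (suc n) → ℕ

data Prop₁ : Set where
  pvar : ℕ → Prop₁
  _p∧_ _p⊔_ _p→_ : Prop₁ → Prop₁ → Prop₁
  pC : Prop₁ → Prop₁
  p⊤ p⊥ : Prop₁

eval₁ : (ℕ → Bool) → Prop₁ → Bool
eval₁ v (pvar i) = v i
eval₁ v (a p∧ b) = eval₁ v a B.∧ eval₁ v b
eval₁ v (a p⊔ b) = eval₁ v a B.∨ eval₁ v b
eval₁ v (a p→ b) = not (eval₁ v a) B.∨ eval₁ v b
eval₁ v (pC a)   = not (eval₁ v a)
eval₁ v p⊤ = true
eval₁ v p⊥ = false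

Taut₁ : Prop₁ → Set
Taut₁ a = ∀ (v : ℕ → Bool) → eval₁ v a ≡ true

data Prop₂ : Set where
  qvar : ℕ → Prop₂
  _q∧_ _q∨_ _q⊃_ : Prop₂ → Prop₂ → Prop₂
  q¬ : Prop₂ → Prop₂
  q⊤ q⊥ : Prop₂

eval₂ : (ℕ → Bool) → Prop₂ → Bool
eval₂ v (qvar i) = v i
eval₂ v (a q∧ b) = eval₂ v a B.∧ eval₂ v b
eval₂ v (a q∨ b) = eval₂ v a B.∨ eval₂ v b
eval₂ v (a q⊃ b) = not (eval₂ v a) B.∨ eval₂ v b
eval₂ v (q¬ a)   = not (eval₂ v a)
eval₂ v q⊤ = true
eval₂ v q⊥ = false

Taut₂ : Prop₂ → Set
Taut₂ a = ∀ (v : ℕ → Bool) → eval₂ v a ≡ true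

module Logic (σ : Signature) where
  open Signature σ
  open import Data.List.Membership.DecPropositional (_≟F_ {suc n})
    using () renaming (_∈?_ to _∈V?_)

  Var : Set
  Var = Fin (suc n)

  Val : Var → Set
  Val X = Fin (suc (ran X))

  Asg : Set
  Asg = Σ Var Val

  -- 𝐗 = 𝐱 as a (possibly empty) list / nonempty list of assignments
  Consistent : List Asg → Set
  Consistent A = ∀ X (x x' : Val X) → (X , x) ∈ A → (X , x') ∈ A → x ≡ x'

  data CO : Set where
    _≐_   : (Y : Var) → Val Y → CO
    _≠_   : (Y : Var) → Val Y → CO
    _∧c_  : CO → CO → CO
    _⊃c_  : CO → CO → CO
    _□→c_ : List⁺ Asg → CO → CO

  data PCO : Set where
    lit≐   : (Y : Var) → Val Y → PCO
    lit≠   : (Y : Var) → Val Y → PCO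
    Pr≥    : CO → I01 → PCO
    Pr>    : CO → I01 → PCO
    Pr≥Pr  : CO → CO → PCO
    Pr>Pr  : CO → CO → PCO
    _∧_    : PCO → PCO → PCO
    _⊔_    : PCO → PCO → PCO
    _⊃_    : CO → PCO → PCO
    _□→_   : List⁺ Asg → PCO → PCO

  infixr 6 _∧_ _∧c_
  infixr 5 _⊔_
  infixr 4 _⊃_ _⊃c_ _□→_ _□→c_

  ⌜_⌝ : CO → PCO
  ⌜ Y ≐ y ⌝ = lit≐ Y y
  ⌜ Y ≠ y ⌝ = lit≠ Y y
  ⌜ a ∧c b ⌝ = ⌜ a ⌝ ∧ ⌜ b ⌝
  ⌜ a ⊃c b ⌝ = a ⊃ ⌜ b ⌝
  ⌜ A □→c a ⌝ = A □→ ⌜ a ⌝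

  -- fixed X, x for ⊤ and ⊥: the first variable and its first value
  X₀ : Var
  X₀ = zero
  x₀ : Val X₀
  x₀ = zero

  single : (X : Var) → Val X → List⁺ Asg
  single X x = (X , x) ∷ []

  ⊤c ⊥c : CO
  ⊤c = single X₀ x₀ □→c (X₀ ≐ x₀)
  ⊥c = single X₀ x₀ □→c (X₀ ≠ x₀)

  ¬c : CO → CO
  ¬c a = a ⊃c ⊥c

  _∨c_ : CO → CO → CO
  a ∨c b = ¬c (¬c a ∧c ¬c b)

  _≡c_ : CO → CO → CO
  a ≡c b = (a ⊃c b) ∧c (b ⊃c a)

  infixr 5 _∨c_

  ⊤ ⊥ : PCO
  ⊤ = ⌜ ⊤c ⌝
  ⊥ = ⌜ ⊥c ⌝

  Pr≤ Pr< Pr≐ Pr≢ : CO → I01 → PCO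
  Pr≤ a e = Pr≥ (¬c a) (oneMinus e)
  Pr< a e = Pr> (¬c a) (oneMinus e)
  Pr≐ a e = Pr≥ a e ∧ Pr≤ a e
  Pr≢ a e = Pr> a e ⊔ Pr< a e

  -- The operation φ ↦ φ^C.  Clauses are tried top to bottom: the
  -- clauses for the abbreviations ⊥, ⊤, Pr(α) ≤ ε, Pr(α) < ε (the
  -- "vice versa" clauses) take precedence over the general ones.

  _ᶜ : PCO → PCO
  -- ⊥^C = ⊤ and ⊤^C = ⊥
  ((zero , zero) ∷ [] □→ lit≠ zero zero) ᶜ = ⊤
  ((zero , zero) ∷ [] □→ lit≐ zero zero) ᶜ = ⊥
  -- (Pr(α) ≤ ε)^C = Pr(α) > ε   (Pr(α) ≤ ε is Pr(¬α) ≥ 1-ε)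
  Pr≥ (a ⊃c ((zero , zero) ∷ [] □→c (zero ≠ zero))) e ᶜ = Pr> a (oneMinus e)
  -- (Pr(α) < ε)^C = Pr(α) ≥ ε   (Pr(α) < ε is Pr(¬α) > 1-ε)
  Pr> (a ⊃c ((zero , zero) ∷ [] □→c (zero ≠ zero))) e ᶜ = Pr≥ a (oneMinus e)
  Pr≥ a e ᶜ = Pr< a e
  Pr> a e ᶜ = Pr≤ a e
  Pr≥Pr a b ᶜ = Pr>Pr b a
  Pr>Pr a b ᶜ = Pr≥Pr b a
  lit≐ X x ᶜ = Pr< (X ≐ x) oneI
  lit≠ X x ᶜ = Pr< (X ≠ x) oneI
  (ψ ∧ χ) ᶜ = (ψ ᶜ) ⊔ (χ ᶜ)
  (ψ ⊔ χ) ᶜ = (ψ ᶜ) ∧ (χ ᶜ)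
  (a ⊃ χ) ᶜ = Pr> a zeroI ∧ (a ⊃ (χ ᶜ))
  (A □→ χ) ᶜ = A □→ (χ ᶜ)

  _⇒_ : PCO → PCO → PCO
  ψ ⇒ χ = (ψ ᶜ) ⊔ χ

  _⇔_ : PCO → PCO → PCO
  ψ ⇔ χ = (ψ ⇒ χ) ∧ (χ ⇒ ψ)

  infixr 3 _⇒_
  infix 2 _⇔_

  ⋁c : List CO → CO
  ⋁c [] = ⊥c
  ⋁c (a ∷ []) = a
  ⋁c (a ∷ as@(_ ∷ _)) = a ∨c ⋁c as

  ⋀c : List CO → CO
  ⋀c [] = ⊤c
  ⋀c (a ∷ []) = a
  ⋀c (a ∷ as@(_ ∷ _)) = a ∧c ⋀c as

  ⨆ : List PCO → PCO
  ⨆ [] = ⊥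
  ⨆ (a ∷ []) = a
  ⨆ (a ∷ as@(_ ∷ _)) = a ⊔ ⨆ as

  ⋀ : List PCO → PCO
  ⋀ [] = ⊤
  ⋀ (a ∷ []) = a
  ⋀ (a ∷ as@(_ ∷ _)) = a ∧ ⋀ as

  eqsC : List⁺ Asg → CO
  eqsC A = ⋀c (map (λ { (X , x) → X ≐ x }) (toList A))

  eqs : List⁺ Asg → PCO
  eqs A = ⋀ (map (λ { (X , x) → lit≐ X x }) (toList A))

  neqs : List⁺ Asg → PCO
  neqs A = ⨆ (map (λ { (X , x) → lit≠ X x }) (toList A))

  allVals : (X : Var) → List (Val X)
  allVals X = allFin (suc (ran X))

  assignments : List Var → List (List Asg)
  assignments [] = [] ∷ []
  assignments (X ∷ Xs) =
    concatMap (λ x → map (λ w → (X , x) ∷ w) (assignments Xs)) (allVals X)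

  sublists : {A : Set} → List A → List (List A)
  sublists [] = [] ∷ []
  sublists (x ∷ xs) = map (x ∷_) (sublists xs) ++ sublists xs

  W₁ : Var → List Var
  W₁ V = filter (λ Z → ¬? (Z ≟F V)) (allFin (suc n))

  W₂ : Var → Var → List Var
  W₂ X Y = filter (λ Z → ¬? (Z ≟F Y)) (W₁ X)

  distinctPairs : (X : Var) → List (Val X × Val X)
  distinctPairs X =
    concatMap (λ x → map (λ x' → (x , x'))
                         (filter (λ x' → ¬? (x ≟F x')) (allVals X)))
              (allVals X)

  φDC : Var → Var → CO
  φDC X Y =
    ⋁c (concatMap (λ { (x , x') →
         concatMap (λ { (y , y') →
           map (λ w → ((w ++⁺ single X x) □→c (Y ≐ y))
                       ∧c ((w ++⁺ single X x') □→c (Y ≐ y')))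
               (assignments (W₂ X Y)) })
         (distinctPairs Y) })
       (distinctPairs X))

  φEnd : Var → PCO
  φEnd Y = ⨆ (map (λ X → ⌜ φDC X Y ⌝) (W₁ Y))

  _⇝_ : Var → Var → CO
  X ⇝ Y =
    ⋁c (concatMap (λ Zs →
         concatMap (λ z →
           concatMap (λ { (x , x') →
             map (λ { (y , y') → ((z ++⁺ single X x) □→c (Y ≐ y))
                                 ∧c ((z ++⁺ single X x') □→c (Y ≐ y')) })
                 (distinctPairs Y) })
           (distinctPairs X))
         (assignments Zs))
       (sublists (W₁ X)))

  chain : Var → Var → List Var → List PCO
  chain X₁ X₂ [] = ⌜ X₁ ⇝ X₂ ⌝ ∷ []
  chain X₁ X₂ (X₃ ∷ Xs) = ⌜ X₁ ⇝ X₂ ⌝ ∷ chain X₂ X₃ Xs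

  lastOf : Var → List Var → Var
  lastOf X [] = X
  lastOf X (Y ∷ Ys) = lastOf Y Ys

  data NoCfC : CO → Set where
    nc≐ : ∀ {Y y} → NoCfC (Y ≐ y)
    nc≠ : ∀ {Y y} → NoCfC (Y ≠ y)
    nc∧ : ∀ {a b} → NoCfC a → NoCfC b → NoCfC (a ∧c b)
    nc⊃ : ∀ {a b} → NoCfC a → NoCfC b → NoCfC (a ⊃c b)

  data NoCf : PCO → Set where
    nc≐ : ∀ {Y y} → NoCf (lit≐ Y y)
    nc≠ : ∀ {Y y} → NoCf (lit≠ Y y)
    ncPr≥ : ∀ {a e} → NoCfC a → NoCf (Pr≥ a e)
    ncPr> : ∀ {a e} → NoCfC a → NoCf (Pr> a e)
    ncPr≥Pr : ∀ {a b} → NoCfC a → NoCfC b → NoCf (Pr≥Pr a b)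
    ncPr>Pr : ∀ {a b} → NoCfC a → NoCfC b → NoCf (Pr>Pr a b)
    nc∧ : ∀ {ψ χ} → NoCf ψ → NoCf χ → NoCf (ψ ∧ χ)
    nc⊔ : ∀ {ψ χ} → NoCf ψ → NoCf χ → NoCf (ψ ⊔ χ)
    nc⊃ : ∀ {a χ} → NoCfC a → NoCf χ → NoCf (a ⊃ χ)

  inst₁ : (ℕ → PCO) → Prop₁ → PCO
  inst₁ s (pvar i) = s i
  inst₁ s (a p∧ b) = inst₁ s a ∧ inst₁ s b
  inst₁ s (a p⊔ b) = inst₁ s a ⊔ inst₁ s b
  inst₁ s (a p→ b) = inst₁ s a ⇒ inst₁ s b
  inst₁ s (pC a) = inst₁ s a ᶜ
  inst₁ s p⊤ = ⊤
  inst₁ s p⊥ = ⊥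

  inst₂ : (ℕ → CO) → Prop₂ → CO
  inst₂ s (qvar i) = s i
  inst₂ s (a q∧ b) = inst₂ s a ∧c inst₂ s b
  inst₂ s (a q∨ b) = inst₂ s a ∨c inst₂ s b
  inst₂ s (a q⊃ b) = inst₂ s a ⊃c inst₂ s b
  inst₂ s (q¬ a) = ¬c (inst₂ s a)
  inst₂ s q⊤ = ⊤c
  inst₂ s q⊥ = ⊥c

  -- Occurrences inside CO positions
  -- (under Pr, in antecedents of ⊃ or inside CO subformulas) may be
  -- replaced only when the result is well formed, i.e. θ, θ' are
  -- (embeddings of) CO formulas.

  module _ (θ θ' : PCO) where
    data ReplC : CO → CO → Set where
      hitC  : ∀ {a a'} → ⌜ a ⌝ ≡ θ → ⌜ a' ⌝ ≡ θ' → ReplC a a'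
      r≐ : ∀ {Y y} → ReplC (Y ≐ y) (Y ≐ y)
      r≠ : ∀ {Y y} → ReplC (Y ≠ y) (Y ≠ y)
      r∧ : ∀ {a a' b b'} → ReplC a a' → ReplC b b' → ReplC (a ∧c b) (a' ∧c b')
      r⊃ : ∀ {a a' b b'} → ReplC a a' → ReplC b b' → ReplC (a ⊃c b) (a' ⊃c b')
      r□→ : ∀ {A a a'} → ReplC a a' → ReplC (A □→c a) (A □→c a')

    data Repl : PCO → PCO → Set where
      hit : Repl θ θ'
      r≐ : ∀ {Y y} → Repl (lit≐ Y y) (lit≐ Y y)
      r≠ : ∀ {Y y} → Repl (lit≠ Y y) (lit≠ Y y)
      rPr≥ : ∀ {a a' e} → ReplC a a' → Repl (Pr≥ a e) (Pr≥ a' e)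
      rPr> : ∀ {a a' e} → ReplC a a' → Repl (Pr> a e) (Pr> a' e)
      rPr≥Pr : ∀ {a a' b b'} → ReplC a a' → ReplC b b' → Repl (Pr≥Pr a b) (Pr≥Pr a' b')
      rPr>Pr : ∀ {a a' b b'} → ReplC a a' → ReplC b b' → Repl (Pr>Pr a b) (Pr>Pr a' b')
      r∧ : ∀ {ψ ψ' χ χ'} → Repl ψ ψ' → Repl χ χ' → Repl (ψ ∧ χ) (ψ' ∧ χ')
      r⊔ : ∀ {ψ ψ' χ χ'} → Repl ψ ψ' → Repl χ χ' → Repl (ψ ⊔ χ) (ψ' ⊔ χ')
      r⊃ : ∀ {a a' χ χ'} → ReplC a a' → Repl χ χ' → Repl (a ⊃ χ) (a' ⊃ χ')
      r□→ : ∀ {A χ χ'} → Repl χ χ' → Repl (A □→ χ) (A □→ χ')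

  data Axiom : PCO → Set where
    T1 : (p : Prop₁) → Taut₁ p → (s : ℕ → PCO) → Axiom (inst₁ s p)
    T2 : (p : Prop₂) → Taut₂ p → (s : ℕ → CO) → Axiom ⌜ inst₂ s p ⌝
    P1 : ∀ a → Axiom (⌜ a ⌝ ⇔ Pr≐ a oneI)
    P2 : ∀ a → Axiom (Pr≥ a zeroI)
    P3 : ∀ a b (δ ε : I01) (h : InUnit (val δ Q.+ val ε)) →
         Axiom ((Pr≐ a δ ∧ Pr≐ b ε ∧ Pr≐ (a ∧c b) zeroI)
                ⇒ Pr≐ (a ∨c b) (mkI _ h))
    P3b : ∀ a b ε → Axiom ((Pr≥ a ε ∧ Pr≐ (a ∧c b) zeroI) ⇒ Pr≤ b (oneMinus ε))
    P4 : ∀ a (δ ε : I01) → val ε < val δ → Axiom (Pr≤ a ε ⇒ Pr< a δ)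
    P5 : ∀ a ε → Axiom (Pr< a ε ⇒ Pr≤ a ε)
    P6 : ∀ a b ε → Axiom (Pr≐ (a ≡c b) oneI ⇒ (Pr≐ a ε ⇒ Pr≐ b ε))
    P6b : ∀ a b ε → Axiom (Pr≐ (a ⊃c b) oneI ⇒ (Pr≐ a ε ⇒ Pr≥ b ε))
    CP1 : ∀ a b (δ ε : I01) → val ε ≤ val δ →
          Axiom ((Pr≐ a δ ∧ Pr≐ b ε) ⇒ Pr≥Pr a b)
    CP2 : ∀ a b (δ ε : I01) → val ε < val δ →
          Axiom ((Pr≐ a δ ∧ Pr≐ b ε) ⇒ Pr>Pr a b)
    O1 : ∀ a ψ → Axiom (Pr≐ a zeroI ⇒ (a ⊃ ψ))
    O1b : ∀ a → Axiom ((a ⊃ ⊥) ⇒ Pr≐ a zeroI)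
    O2 : ∀ a b (δ ε : I01) .{{_ : NonZero (val δ)}} →
         (h : InUnit (val ε Q.÷ val δ)) →
         Axiom ((Pr≐ a δ ∧ Pr≐ (a ∧c b) ε) ⇒ (a ⊃ Pr≐ b (mkI _ h)))
    O3 : ∀ a b (δ ε : I01) → NonZero (val ε) →
         Axiom ((a ⊃ Pr≐ b ε) ⇒ (Pr≐ a δ ⇔ Pr≐ (a ∧c b) (timesI ε δ)))
    O4 : ∀ a ψ → Axiom ((a ⊃ ψ) ⇒ (⌜ a ⌝ ⇒ ψ))
    O5∧ : ∀ a ψ χ → Axiom ((a ⊃ (ψ ∧ χ)) ⇔ ((a ⊃ ψ) ∧ (a ⊃ χ)))
    O5⊔ : ∀ a ψ χ → Axiom ((a ⊃ (ψ ⊔ χ)) ⇔ ((a ⊃ ψ) ⊔ (a ⊃ χ)))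
    O5⊃ : ∀ a b χ → Axiom ((a ⊃ (b ⊃ χ)) ⇔ ((a ∧c b) ⊃ χ))
    A1 : ∀ (A A' : List⁺ Asg) → L⁺.map proj₁ A ≡ L⁺.map proj₁ A' → A ≢ A' →
         Axiom (eqs A ⇒ neqs A')
    A2 : ∀ X x → Axiom (lit≠ X x ⇔ (X ≐ x ⊃ ⊥))
    A3 : ∀ (Ys : List⁺ Var) →
         Axiom ⌜ ⋁c (map eqsC (concatMap (λ { [] → [] ; (a ∷ as) → (a ∷ as) ∷ [] })
                                         (assignments (toList Ys)))) ⌝
    C1 : ∀ A ψ χ → Axiom ((A □→ (ψ ∧ χ)) ⇔ ((A □→ ψ) ∧ (A □→ χ)))
    C2 : ∀ A ψ χ → Axiom ((A □→ (ψ ⊔ χ)) ⇔ ((A □→ ψ) ⊔ (A □→ χ)))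
    C3 : ∀ A a χ → Axiom ((A □→ (a ⊃ χ)) ⇔ ((A □→c a) ⊃ (A □→ χ)))
    C4 : ∀ (A B : List⁺ Asg) χ → Consistent (toList A) →
         Axiom ((A □→ (B □→ χ)) ⇒
                ((filter (λ { (X , _) → ¬? (X ∈V? toList (L⁺.map proj₁ B)) }) (toList A)
                  ++⁺ B) □→ χ))
    C4b : ∀ (A B : List⁺ Asg) χ → Axiom (((A ⁺++⁺ B) □→ χ) ⇒ (A □→ (B □→ χ)))
    C5 : ∀ (A : List⁺ Asg) ψ → Consistent (toList A) → Axiom ((A □→ ⊥) ⇒ ψ)
    C6 : ∀ (A : List Asg) Y y → Axiom ⌜ (A ++⁺ single Y y) □→c (Y ≐ y) ⌝
    C7 : ∀ (A : List⁺ Asg) γ → NoCf γ → Axiom ((eqs A ∧ γ) ⇒ (A □→ γ))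
    C8≥ : ∀ A a ε → Axiom ((A □→ Pr≥ a ε) ⇔ Pr≥ (A □→c a) ε)
    C8> : ∀ A a ε → Axiom ((A □→ Pr> a ε) ⇔ Pr> (A □→c a) ε)
    C8b≥ : ∀ A a b → Axiom ((A □→ Pr≥Pr a b) ⇔ Pr≥Pr (A □→c a) (A □→c b))
    C8b> : ∀ A a b → Axiom ((A □→ Pr>Pr a b) ⇔ Pr>Pr (A □→c a) (A □→c b))
    C9 : ∀ Y (w : Asg) (ws : List Asg) → (w ∷ ws) ∈ assignments (W₁ Y) →
         Axiom (φEnd Y ⇒ ((w ∷ ws) □→ ⨆ (map (lit≐ Y) (allVals Y))))
    C10 : ∀ Y y (w : Asg) (ws : List Asg) → (w ∷ ws) ∈ assignments (W₁ Y) →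
          Axiom ((φEnd Y ᶜ) ⇒ (Y ≐ y ⊃ ((w ∷ ws) □→ lit≐ Y y)))
    C11 : ∀ (X₁ X₂ : Var) (Xs : List Var) →
          Axiom (⋀ (chain X₁ X₂ Xs) ⇒ (⌜ lastOf X₂ Xs ⇝ X₁ ⌝ ᶜ))

  infix 1 _⊢_

  data _⊢_ : Pred PCO 0ℓ → PCO → Set₁ where
    ax   : ∀ {Γ φ} → Axiom φ → Γ ⊢ φ
    hyp  : ∀ {Γ φ} → Γ φ → Γ ⊢ φ
    MP   : ∀ {Γ ψ χ} → Γ ⊢ ψ → Γ ⊢ (ψ ⇒ χ) → Γ ⊢ χ
    Rep  : ∀ {Γ φ θ θ' φ'} → ∅ ⊢ φ → ∅ ⊢ (θ ⇔ θ') → Repl θ θ' φ φ' → Γ ⊢ φ'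
    ⊥ω   : ∀ {Γ ψ a} → (∀ (ε : I01) → Γ ⊢ (ψ ⇒ Pr≢ a ε)) → Γ ⊢ (ψ ⇒ ⊥)
    Mon⊃ : ∀ {Γ ψ χ} a → ∅ ⊢ (ψ ⇒ χ) → Γ ⊢ ((a ⊃ ψ) ⇒ (a ⊃ χ))
    →to⊃ : ∀ {Γ a ψ} → ∅ ⊢ (⌜ a ⌝ ⇒ ψ) → Γ ⊢ (a ⊃ ψ)
    ⊃ω   : ∀ {Γ ψ a b} (δ : I01) →
           (∀ (ε : I01) → 0ℚ < val ε →
              Γ ⊢ (ψ ⇒ (Pr≐ (a ∧c b) (timesI δ ε) ⇔ Pr≐ a ε))) →
           Γ ⊢ (ψ ⇒ (a ⊃ Pr≐ b δ))
    Mon□→ : ∀ {Γ ψ χ} A → ∅ ⊢ (ψ ⇒ χ) → Γ ⊢ ((A □→ ψ) ⇒ (A □→ χ))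

-- Induction on the derivation of ψ from Γ ∪ {φ}, exactly as for the Hilbert
-- calculus: the hypothesis φ gives φ ⇒ φ, axioms, other hypotheses and the
-- rules restricted to theorems give formulas that are merely weakened to φ ⇒ _,
-- and MP is pushed under φ by the tautology S.  The only new point is the two
-- infinitary rules ⊥ω and ⊃ω; both carry an arbitrary antecedent ψ, so φ is
-- absorbed into it by currying φ ⇒ (ψ ⇒ χ) into (φ ∧ ψ) ⇒ χ and back.
module Submission where

open import Defs
open import Relation.Unary using (Pred; _∪_; ｛_｝; _⊆_)
open import Level using (0ℓ)
open import Data.Nat using (ℕ; zero; suc)
open import Data.Bool using (true; false)
open import Data.List using (List; []; _∷_)
open import Data.Sum using (inj₁; inj₂)
open import Relation.Binary.PropositionalEquality using (refl)

module DeductionTheorem (σ : Signature) where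
  open Logic σ

  p₀ p₁ p₂ : Prop₁
  p₀ = pvar 0
  p₁ = pvar 1
  p₂ = pvar 2

  K-tautology : Taut₁ (p₀ p→ (p₁ p→ p₀))
  K-tautology v with v 0 | v 1
  ... | false | _     = refl
  ... | true  | true  = refl
  ... | true  | false = refl

  I-tautology : Taut₁ (p₀ p→ p₀)
  I-tautology v with v 0
  ... | true  = refl
  ... | false = refl

  S-tautology : Taut₁ ((p₀ p→ p₁) p→ ((p₀ p→ (p₁ p→ p₂)) p→ (p₀ p→ p₂)))
  S-tautology v with v 0 | v 1 | v 2
  ... | false | _     | _     = refl
  ... | true  | false | _     = refl
  ... | true  | true  | true  = refl
  ... | true  | true  | false = refl

  curry-tautology : Taut₁ ((p₀ p→ (p₁ p→ p₂)) p→ ((p₀ p∧ p₁) p→ p₂))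
  curry-tautology v with v 0 | v 1 | v 2
  ... | false | _     | _     = refl
  ... | true  | false | _     = refl
  ... | true  | true  | true  = refl
  ... | true  | true  | false = refl

  uncurry-tautology : Taut₁ (((p₀ p∧ p₁) p→ p₂) p→ (p₀ p→ (p₁ p→ p₂)))
  uncurry-tautology v with v 0 | v 1 | v 2
  ... | false | _     | _     = refl
  ... | true  | false | _     = refl
  ... | true  | true  | true  = refl
  ... | true  | true  | false = refl

  substitution : List PCO → ℕ → PCO
  substitution []       _       = ⊤
  substitution (φ ∷ _)  zero    = φ
  substitution (_ ∷ φs) (suc i) = substitution φs i

  tautological-MP : ∀ {Γ} p q → Taut₁ (p p→ q) → (s : ℕ → PCO) →
                    Γ ⊢ inst₁ s p → Γ ⊢ inst₁ s q
  tautological-MP p q taut s d = MP {ψ = inst₁ s p} d (ax (T1 (p p→ q) taut s))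

  weaken : ∀ {Γ} φ {χ} → Γ ⊢ χ → Γ ⊢ (φ ⇒ χ)
  weaken φ {χ} =
    tautological-MP p₀ (p₁ p→ p₀) K-tautology (substitution (χ ∷ φ ∷ []))

  ⇒-refl : ∀ {Γ} φ → Γ ⊢ (φ ⇒ φ)
  ⇒-refl φ = ax (T1 (p₀ p→ p₀) I-tautology (substitution (φ ∷ [])))

  MP-under : ∀ {Γ φ ψ χ} → Γ ⊢ (φ ⇒ ψ) → Γ ⊢ (φ ⇒ (ψ ⇒ χ)) → Γ ⊢ (φ ⇒ χ)
  MP-under {φ = φ} {ψ} {χ} d e =
    MP {ψ = φ ⇒ (ψ ⇒ χ)} e
      (tautological-MP (p₀ p→ p₁) ((p₀ p→ (p₁ p→ p₂)) p→ (p₀ p→ p₂)) S-tautology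
        (substitution (φ ∷ ψ ∷ χ ∷ [])) d)

  curry : ∀ {Γ} φ ψ χ → Γ ⊢ (φ ⇒ (ψ ⇒ χ)) → Γ ⊢ ((φ ∧ ψ) ⇒ χ)
  curry φ ψ χ =
    tautological-MP (p₀ p→ (p₁ p→ p₂)) ((p₀ p∧ p₁) p→ p₂) curry-tautology
      (substitution (φ ∷ ψ ∷ χ ∷ []))

  uncurry : ∀ {Γ} φ ψ χ → Γ ⊢ ((φ ∧ ψ) ⇒ χ) → Γ ⊢ (φ ⇒ (ψ ⇒ χ))
  uncurry φ ψ χ =
    tautological-MP ((p₀ p∧ p₁) p→ p₂) (p₀ p→ (p₁ p→ p₂)) uncurry-tautology
      (substitution (φ ∷ ψ ∷ χ ∷ []))

  module _ {Δ Γ : Pred PCO 0ℓ} {φ : PCO} (Δ⊆Γ∪φ : Δ ⊆ Γ ∪ ｛ φ ｝) where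

    deduction : ∀ {ψ} → Δ ⊢ ψ → Γ ⊢ (φ ⇒ ψ)
    deduction (ax a) = weaken φ (ax a)
    deduction (hyp h) with Δ⊆Γ∪φ h
    ... | inj₁ h′   = weaken φ (hyp h′)
    ... | inj₂ refl = ⇒-refl φ
    deduction (MP {ψ = ψ} {χ} d e) =
      MP-under {φ = φ} {ψ} {χ} (deduction d) (deduction e)
    deduction (Rep d e r) = weaken φ (Rep d e r)
    deduction (⊥ω {ψ = ψ} {a} f) =
      uncurry φ ψ ⊥ (⊥ω {ψ = φ ∧ ψ} {a} (λ ε → curry φ ψ (Pr≢ a ε) (deduction (f ε))))
    deduction (Mon⊃ {ψ = ψ} {χ} a d) = weaken φ (Mon⊃ {ψ = ψ} {χ} a d)
    deduction (→to⊃ d) = weaken φ (→to⊃ d)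
    deduction (⊃ω {ψ = ψ} {a} {b} δ f) =
      uncurry φ ψ (a ⊃ Pr≐ b δ) (⊃ω {ψ = φ ∧ ψ} {a} {b} δ (λ ε ε>0 →
        curry φ ψ (Pr≐ (a ∧c b) (timesI δ ε) ⇔ Pr≐ a ε) (deduction (f ε ε>0))))
    deduction (Mon□→ A d) = weaken φ (Mon□→ A d)

mainTheorem3 : (σ : Signature) → let open Logic σ in
    (Γ : Pred PCO 0ℓ) (φ ψ : PCO) →
    (Γ ∪ ｛ φ ｝) ⊢ ψ → Γ ⊢ (φ ⇒ ψ)
mainTheorem3 σ Γ φ ψ = DeductionTheorem.deduction σ {φ = φ} (λ h → h)
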